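{- For each $n\ge1$, the polynomial $P_n^{\mathrm{id},\mathrm{id}}(x)=\sum_{m=0}^n a_{n,m}x^m$ has coefficients $$a_{n,m}=\frac{A^{\mathrm{id},\mathrm{id}}_{n,m}}{n!}=\frac{1}{m!}\binom{n-1}{m-1}\qquad(1\le m\le n),$$ and it is ultra-log-concave, i.e. the sequence $a_{n,0},a_{n,1},\dots,a_{n,n}$ is non-negative and $\big(a_{n,k}/\binom{n}{k}\big)_{k=0}^n$ is log-concave.
   Context: Define $P_0^{\mathrm{id},\mathrm{id}}(x):=1$ and, for $n\ge1$, $P_n^{\mathrm{id},\mathrm{id}}(x):=\frac{x}{n}\sum_{k=1}^n k\,P_{n-k}^{\mathrm{id},\mathrm{id}}(x)$; $A_{n,m}^{\mathrm{id},\mathrm{id}}$ is the coefficient of $x^m$ in $n!\,P_n^{\mathrm{id},\mathrm{id}}(x)$. A finite sequence $b_0,\dots,b_n$ of non-negative reals is log-concave if $b_j^2\ge b_{j-1}b_{j+1}$ for all $1\le j\le n-1$. -}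

module Defs where

open import Data.Nat using (ℕ; zero; suc; _∸_; _!)
open import Data.Nat.Combinatorics using (_C_)
open import Data.Rational using (ℚ; 0ℚ; 1ℚ; _+_; _*_; _/_)
open import Data.List using (List; []; _∷_)
open import Data.Product using (_×_)

-- A polynomial over ℚ is represented by its coefficient function ℕ → ℚ
-- (coefficient of x^m).
Poly : Set
Poly = ℕ → ℚ

xmul : Poly → Poly
xmul p zero = 0ℚ
xmul p (suc m) = p m

-- Given [P_{n-1}, P_{n-2}, ..., P_0] (length n), compute  Σ_{k=1}^n k P_{n-k}.
-- The head of the list is P_{n-1} (k = 1), etc.
weightedSum : ℕ → List Poly → Poly
weightedSum k [] m = 0ℚ
weightedSum k (p ∷ ps) m = (+ k / 1) * p m + weightedSum (suc k) ps m
  where open import Data.Integer using (+_)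

-- Ps n = [P_n, P_{n-1}, ..., P_0], where P_0 = 1 and for n ≥ 1
-- P_n(x) = (x / n) Σ_{k=1}^n k P_{n-k}(x).
Ps : ℕ → List Poly
Ps zero = (λ { zero → 1ℚ ; (suc _) → 0ℚ }) ∷ []
Ps (suc n) = Pnew ∷ Ps n
  where
  open import Data.Integer using (+_)
  Pnew : Poly
  Pnew m = (+ 1 / suc n) * xmul (weightedSum 1 (Ps n)) m

headP : List Poly → Poly
headP [] m = 0ℚ
headP (p ∷ _) = p

P : ℕ → Poly
P n = headP (Ps n)

a : ℕ → ℕ → ℚ
a n m = P n m

A : ℕ → ℕ → ℚ
A n m = (+ (n !) / 1) * P n m
  where open import Data.Integer using (+_)

-- q / d for a natural number d (only used with d ≠ 0; d = 0 gives 0 by convention)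
divN : ℚ → ℕ → ℚ
divN q zero = 0ℚ
divN q (suc d) = q * (+ 1 / suc d)
  where open import Data.Integer using (+_)

ℕtoℚ : ℕ → ℚ
ℕtoℚ k = + k / 1
  where open import Data.Integer using (+_)

NonNegSeq : ℕ → (ℕ → ℚ) → Set
NonNegSeq n b = ∀ j → j Data.Nat.≤ n → 0ℚ Data.Rational.≤ b j

LogConcave : ℕ → (ℕ → ℚ) → Set
LogConcave n b = ∀ j → 1 Data.Nat.≤ j → j Data.Nat.≤ n ∸ 1 →
  b (j ∸ 1) * b (suc j) Data.Rational.≤ b j * b j

module Submission where

-- Write Uₙ = P₀ + ⋯ + Pₙ and Wₙ = Σ_{k=1}^{n+1} k P_{n+1-k}, so that P_{n+1} = x Wₙ / (n+1),
-- U_{n+1} = P_{n+1} + Uₙ and W_{n+1} = P_{n+1} + Wₙ + Uₙ.  By induction on n,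
-- m! [x^m] Uₙ = C(n,m) and m! [x^m] Wₙ = C(n+1,m+1): the absorption identity
-- (m+1) C(n+1,m+1) = (n+1) C(n,m) turns the second into m! [x^m] P_{n+1} = C(n,m-1), and then
-- both recursions are Pascal's rule.  Dividing by C(n+1,k+1) turns a_{n+1,k+1} into
-- 1/((n+1) k!), so ultra-log-concavity comes down to (k+1)!² ≤ k! (k+2)!, that is k+1 ≤ k+2.

open import Defs
open import Data.Nat using (ℕ; zero; suc; _∸_; _!; NonZero; s≤s)
import Data.Nat as ℕ
import Data.Nat.Properties as ℕ
import Data.Nat.Tactic.RingSolver as ℕ-Solver
open import Data.Nat.Combinatorics using (_C_; nC1≡n; nCk+nC[k+1]≡[n+1]C[k+1])
open import Data.Integer as ℤ using (+_)
import Data.Integer.Properties as ℤ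
import Data.Integer.Tactic.RingSolver as ℤ-Solver
open import Data.Rational using (ℚ; 0ℚ; 1ℚ; _+_; _*_; _/_; _≤_; toℚᵘ; nonNegative)
open import Data.Rational.Properties
open import Data.Rational.Solver using (module +-*-Solver)
open import Data.Rational.Unnormalised as ℚᵘ using (mkℚᵘ; _≃_; *≡*)
import Data.Rational.Unnormalised.Properties as ℚᵘ
open import Data.List using (List; []; _∷_)
open import Data.Product using (_×_; _,_; proj₂)
open import Relation.Binary.PropositionalEquality

toℚᵘ-ℕtoℚ : ∀ k → toℚᵘ (ℕtoℚ k) ≃ mkℚᵘ (+ k) 0
toℚᵘ-ℕtoℚ k = toℚᵘ-fromℚᵘ (mkℚᵘ (+ k) 0)

ℕtoℚ-+ : ∀ m n → ℕtoℚ (m ℕ.+ n) ≡ ℕtoℚ m + ℕtoℚ n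
ℕtoℚ-+ m n = toℚᵘ-injective (begin-equality
  toℚᵘ (ℕtoℚ (m ℕ.+ n))            ≃⟨ toℚᵘ-ℕtoℚ (m ℕ.+ n) ⟩
  mkℚᵘ (+ (m ℕ.+ n)) 0             ≃⟨ *≡* (trans (cong (ℤ._* + 1) (ℤ.pos-+ m n)) (ℤ-identity (+ m) (+ n))) ⟩
  mkℚᵘ (+ m) 0 ℚᵘ.+ mkℚᵘ (+ n) 0    ≃⟨ ℚᵘ.+-cong (toℚᵘ-ℕtoℚ m) (toℚᵘ-ℕtoℚ n) ⟨
  toℚᵘ (ℕtoℚ m) ℚᵘ.+ toℚᵘ (ℕtoℚ n)  ≃⟨ toℚᵘ-homo-+ (ℕtoℚ m) (ℕtoℚ n) ⟨
  toℚᵘ (ℕtoℚ m + ℕtoℚ n)           ∎)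
  where
  open ℚᵘ.≤-Reasoning
  ℤ-identity : ∀ a b → (a ℤ.+ b) ℤ.* + 1 ≡ (a ℤ.* + 1 ℤ.+ b ℤ.* + 1) ℤ.* + 1
  ℤ-identity = ℤ-Solver.solve-∀

ℕtoℚ-* : ∀ m n → ℕtoℚ (m ℕ.* n) ≡ ℕtoℚ m * ℕtoℚ n
ℕtoℚ-* m n = toℚᵘ-injective (begin-equality
  toℚᵘ (ℕtoℚ (m ℕ.* n))            ≃⟨ toℚᵘ-ℕtoℚ (m ℕ.* n) ⟩
  mkℚᵘ (+ (m ℕ.* n)) 0             ≃⟨ *≡* (cong (ℤ._* + 1) (ℤ.pos-* m n)) ⟩
  mkℚᵘ (+ m) 0 ℚᵘ.* mkℚᵘ (+ n) 0    ≃⟨ ℚᵘ.*-cong (toℚᵘ-ℕtoℚ m) (toℚᵘ-ℕtoℚ n) ⟨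
  toℚᵘ (ℕtoℚ m) ℚᵘ.* toℚᵘ (ℕtoℚ n)  ≃⟨ toℚᵘ-homo-* (ℕtoℚ m) (ℕtoℚ n) ⟨
  toℚᵘ (ℕtoℚ m * ℕtoℚ n)           ∎)
  where open ℚᵘ.≤-Reasoning

ℕtoℚ≥0 : ∀ k → 0ℚ ≤ ℕtoℚ k
ℕtoℚ≥0 k = nonNegative⁻¹ (ℕtoℚ k) {{normalize-nonNeg k 1}}

ℕtoℚ-mono-≤ : ∀ {m n} → m ℕ.≤ n → ℕtoℚ m ≤ ℕtoℚ n
ℕtoℚ-mono-≤ {m} {n} m≤n = begin
  ℕtoℚ m                      ≡⟨ +-identityʳ (ℕtoℚ m) ⟨
  ℕtoℚ m + 0ℚ                 ≤⟨ +-monoʳ-≤ (ℕtoℚ m) (ℕtoℚ≥0 (n ∸ m)) ⟩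
  ℕtoℚ m + ℕtoℚ (n ∸ m)       ≡⟨ ℕtoℚ-+ m (n ∸ m) ⟨
  ℕtoℚ (m ℕ.+ (n ∸ m))        ≡⟨ cong ℕtoℚ (ℕ.m+[n∸m]≡n m≤n) ⟩
  ℕtoℚ n                      ∎
  where open ≤-Reasoning

-- Following divN, 1/ℕ 0 = 0; this makes 1/ℕ-* hold without side conditions.
1/ℕ : ℕ → ℚ
1/ℕ d = divN 1ℚ d

1/ℕ≥0 : ∀ d → 0ℚ ≤ 1/ℕ d
1/ℕ≥0 zero    = ≤-refl
1/ℕ≥0 (suc d) = nonNegative⁻¹ (1/ℕ (suc d))
  {{nonNeg*nonNeg⇒nonNeg 1ℚ (+ 1 / suc d) {{normalize-nonNeg 1 (suc d)}}}}

divN≡*1/ℕ : ∀ q d → divN q d ≡ q * 1/ℕ d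
divN≡*1/ℕ q zero    = sym (*-zeroʳ q)
divN≡*1/ℕ q (suc d) = cong (q *_) (sym (*-identityˡ (+ 1 / suc d)))

*-nonNeg : ∀ {p q} → 0ℚ ≤ p → 0ℚ ≤ q → 0ℚ ≤ p * q
*-nonNeg {p} {q} p≥0 q≥0 =
  nonNegative⁻¹ (p * q) {{nonNeg*nonNeg⇒nonNeg p {{nonNegative p≥0}} q {{nonNegative q≥0}}}}

divN-nonNeg : ∀ {q} d → 0ℚ ≤ q → 0ℚ ≤ divN q d
divN-nonNeg {q} d q≥0 = subst (0ℚ ≤_) (sym (divN≡*1/ℕ q d)) (*-nonNeg q≥0 (1/ℕ≥0 d))

ℕtoℚ*1/ℕ≡1 : ∀ d .{{_ : NonZero d}} → ℕtoℚ d * 1/ℕ d ≡ 1ℚ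
ℕtoℚ*1/ℕ≡1 (suc d) = toℚᵘ-injective (begin-equality
  toℚᵘ (ℕtoℚ (suc d) * 1/ℕ (suc d))               ≃⟨ toℚᵘ-cong (cong (ℕtoℚ (suc d) *_) (*-identityˡ (+ 1 / suc d))) ⟩
  toℚᵘ (ℕtoℚ (suc d) * (+ 1 / suc d))             ≃⟨ toℚᵘ-homo-* (ℕtoℚ (suc d)) (+ 1 / suc d) ⟩
  toℚᵘ (ℕtoℚ (suc d)) ℚᵘ.* toℚᵘ (+ 1 / suc d)     ≃⟨ ℚᵘ.*-cong (toℚᵘ-ℕtoℚ (suc d)) (toℚᵘ-fromℚᵘ (mkℚᵘ (+ 1) d)) ⟩
  mkℚᵘ (+ suc d) 0 ℚᵘ.* mkℚᵘ (+ 1) d             ≃⟨ ℚᵘ.*-inverseʳ (mkℚᵘ (+ suc d) 0) ⟩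
  ℚᵘ.1ℚᵘ                                          ∎)
  where open ℚᵘ.≤-Reasoning

ℕtoℚ-cancelˡ : ∀ d .{{_ : NonZero d}} {x y} → ℕtoℚ d * x ≡ ℕtoℚ d * y → x ≡ y
ℕtoℚ-cancelˡ d {x} {y} dx≡dy = begin
  x                      ≡⟨ 1/ℕ*ℕtoℚ* x ⟨
  1/ℕ d * (ℕtoℚ d * x)   ≡⟨ cong (1/ℕ d *_) dx≡dy ⟩
  1/ℕ d * (ℕtoℚ d * y)   ≡⟨ 1/ℕ*ℕtoℚ* y ⟩
  y                      ∎
  where
  open ≡-Reasoning
  open +-*-Solver
  1/ℕ*ℕtoℚ* : ∀ z → 1/ℕ d * (ℕtoℚ d * z) ≡ z
  1/ℕ*ℕtoℚ* z = begin
    1/ℕ d * (ℕtoℚ d * z)  ≡⟨ solve 3 (λ r n z → r :* (n :* z) := (n :* r) :* z) refl (1/ℕ d) (ℕtoℚ d) z ⟩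
    (ℕtoℚ d * 1/ℕ d) * z  ≡⟨ cong (_* z) (ℕtoℚ*1/ℕ≡1 d) ⟩
    1ℚ * z                ≡⟨ *-identityˡ z ⟩
    z                     ∎

d*x≡y⇒x≡y/d : ∀ d .{{_ : NonZero d}} {x y} → ℕtoℚ d * x ≡ y → x ≡ divN y d
d*x≡y⇒x≡y/d d {x} {y} dx≡y = ℕtoℚ-cancelˡ d (begin
  ℕtoℚ d * x             ≡⟨ dx≡y ⟩
  y                      ≡⟨ *-identityʳ y ⟨
  y * 1ℚ                 ≡⟨ cong (y *_) (ℕtoℚ*1/ℕ≡1 d) ⟨
  y * (ℕtoℚ d * 1/ℕ d)   ≡⟨ solve 3 (λ y n r → y :* (n :* r) := n :* (y :* r)) refl y (ℕtoℚ d) (1/ℕ d) ⟩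
  ℕtoℚ d * (y * 1/ℕ d)   ≡⟨ cong (ℕtoℚ d *_) (divN≡*1/ℕ y d) ⟨
  ℕtoℚ d * divN y d      ∎)
  where
  open ≡-Reasoning
  open +-*-Solver

1/ℕ-* : ∀ m n → 1/ℕ (m ℕ.* n) ≡ 1/ℕ m * 1/ℕ n
1/ℕ-* zero    n       = sym (*-zeroˡ (1/ℕ n))
1/ℕ-* (suc m) zero    = trans (cong 1/ℕ (ℕ.*-zeroʳ (suc m))) (sym (*-zeroʳ (1/ℕ (suc m))))
1/ℕ-* (suc m) (suc n) = ℕtoℚ-cancelˡ (suc m ℕ.* suc n) (begin
  ℕtoℚ (suc m ℕ.* suc n) * 1/ℕ (suc m ℕ.* suc n)
    ≡⟨ ℕtoℚ*1/ℕ≡1 (suc m ℕ.* suc n) ⟩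
  1ℚ
    ≡⟨ cong₂ _*_ (ℕtoℚ*1/ℕ≡1 (suc m)) (ℕtoℚ*1/ℕ≡1 (suc n)) ⟨
  (M * M⁻¹) * (N * N⁻¹)
    ≡⟨ solve 4 (λ a r b s → (a :* r) :* (b :* s) := (a :* b) :* (r :* s)) refl M M⁻¹ N N⁻¹ ⟩
  (M * N) * (M⁻¹ * N⁻¹)
    ≡⟨ cong (_* (M⁻¹ * N⁻¹)) (ℕtoℚ-* (suc m) (suc n)) ⟨
  ℕtoℚ (suc m ℕ.* suc n) * (M⁻¹ * N⁻¹) ∎)
  where
  open ≡-Reasoning
  open +-*-Solver
  M N M⁻¹ N⁻¹ : ℚ
  M   = ℕtoℚ (suc m)
  N   = ℕtoℚ (suc n)
  M⁻¹ = 1/ℕ (suc m)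
  N⁻¹ = 1/ℕ (suc n)

1/ℕ-antimono-≤ : ∀ {m n} .{{_ : NonZero m}} → m ℕ.≤ n → 1/ℕ n ≤ 1/ℕ m
1/ℕ-antimono-≤ {m} {n} m≤n = begin
  1/ℕ n
    ≡⟨ *-identityˡ (1/ℕ n) ⟨
  1ℚ * 1/ℕ n
    ≡⟨ cong (_* 1/ℕ n) (ℕtoℚ*1/ℕ≡1 m) ⟨
  ℕtoℚ m * 1/ℕ m * 1/ℕ n
    ≤⟨ *-monoʳ-≤-nonNeg (1/ℕ n) {{nonNegative (1/ℕ≥0 n)}} (*-monoʳ-≤-nonNeg (1/ℕ m) {{nonNegative (1/ℕ≥0 m)}} (ℕtoℚ-mono-≤ m≤n)) ⟩
  ℕtoℚ n * 1/ℕ m * 1/ℕ n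
    ≡⟨ solve 3 (λ a r s → a :* r :* s := (a :* s) :* r) refl (ℕtoℚ n) (1/ℕ m) (1/ℕ n) ⟩
  (ℕtoℚ n * 1/ℕ n) * 1/ℕ m
    ≡⟨ cong (_* 1/ℕ m) (ℕtoℚ*1/ℕ≡1 n {{ℕ.>-nonZero (ℕ.<-≤-trans (ℕ.>-nonZero⁻¹ m) m≤n)}}) ⟩
  1ℚ * 1/ℕ m
    ≡⟨ *-identityˡ (1/ℕ m) ⟩
  1/ℕ m ∎
  where
  open ≤-Reasoning
  open +-*-Solver

1/ℕ-*-antimono-≤ : ∀ x y z .{{_ : NonZero y}} → y ℕ.* y ℕ.≤ x ℕ.* z → 1/ℕ x * 1/ℕ z ≤ 1/ℕ y * 1/ℕ y
1/ℕ-*-antimono-≤ x y z yy≤xz = begin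
  1/ℕ x * 1/ℕ z    ≡⟨ 1/ℕ-* x z ⟨
  1/ℕ (x ℕ.* z)    ≤⟨ 1/ℕ-antimono-≤ {{ℕ.m*n≢0 y y}} yy≤xz ⟩
  1/ℕ (y ℕ.* y)    ≡⟨ 1/ℕ-* y y ⟩
  1/ℕ y * 1/ℕ y    ∎
  where open ≤-Reasoning

-- n choose (m - 1); unlike n C (m ∸ 1), it vanishes at m = 0.
C₋₁ : ℕ → ℕ → ℕ
C₋₁ n zero    = 0
C₋₁ n (suc m) = n C m

[n+1]Cm≡C₋₁+nCm : ∀ n m → suc n C m ≡ C₋₁ n m ℕ.+ n C m
[n+1]Cm≡C₋₁+nCm n zero    = refl
[n+1]Cm≡C₋₁+nCm n (suc m) = sym (nCk+nC[k+1]≡[n+1]C[k+1] n m)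

[k+1]*[n+1]C[k+1]≡[n+1]*nCk : ∀ n k → suc k ℕ.* (suc n C suc k) ≡ suc n ℕ.* (n C k)
[k+1]*[n+1]C[k+1]≡[n+1]*nCk n       zero    =
  trans (ℕ.*-identityˡ (suc n C 1)) (trans (nC1≡n (suc n)) (sym (ℕ.*-identityʳ (suc n))))
[k+1]*[n+1]C[k+1]≡[n+1]*nCk zero    (suc k) = ℕ.*-zeroʳ (suc (suc k))
[k+1]*[n+1]C[k+1]≡[n+1]*nCk (suc n) (suc k) = begin
  suc (suc k) ℕ.* (suc (suc n) C suc (suc k))
    ≡⟨ cong (suc (suc k) ℕ.*_) (nCk+nC[k+1]≡[n+1]C[k+1] (suc n) (suc k)) ⟨
  suc (suc k) ℕ.* (c ℕ.+ c′)
    ≡⟨ regroupˡ k c c′ ⟩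
  suc k ℕ.* c ℕ.+ c ℕ.+ suc (suc k) ℕ.* c′
    ≡⟨ cong₂ (λ u v → u ℕ.+ c ℕ.+ v) ([k+1]*[n+1]C[k+1]≡[n+1]*nCk n k) ([k+1]*[n+1]C[k+1]≡[n+1]*nCk n (suc k)) ⟩
  suc n ℕ.* (n C k) ℕ.+ c ℕ.+ suc n ℕ.* (n C suc k)
    ≡⟨ regroupʳ n c (n C k) (n C suc k) ⟩
  suc n ℕ.* (n C k ℕ.+ n C suc k) ℕ.+ c
    ≡⟨ cong (λ u → suc n ℕ.* u ℕ.+ c) (nCk+nC[k+1]≡[n+1]C[k+1] n k) ⟩
  suc n ℕ.* c ℕ.+ c
    ≡⟨ ℕ.+-comm (suc n ℕ.* c) c ⟩
  suc (suc n) ℕ.* c ∎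
  where
  open ≡-Reasoning
  c c′ : ℕ
  c  = suc n C suc k
  c′ = suc n C suc (suc k)
  regroupˡ : ∀ k c c′ → suc (suc k) ℕ.* (c ℕ.+ c′) ≡ suc k ℕ.* c ℕ.+ c ℕ.+ suc (suc k) ℕ.* c′
  regroupˡ = ℕ-Solver.solve-∀
  regroupʳ : ∀ n c a b → suc n ℕ.* a ℕ.+ c ℕ.+ suc n ℕ.* b ≡ suc n ℕ.* (a ℕ.+ b) ℕ.+ c
  regroupʳ = ℕ-Solver.solve-∀

k≤n⇒nCk≢0 : ∀ {n k} → k ℕ.≤ n → NonZero (n C k)
k≤n⇒nCk≢0 {k = zero}        _         = _
k≤n⇒nCk≢0 {suc n} {suc k}   (s≤s k≤n) =
  subst NonZero (nCk+nC[k+1]≡[n+1]C[k+1] n k)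
    (ℕ.>-nonZero (ℕ.<-≤-trans (ℕ.>-nonZero⁻¹ (n C k) {{k≤n⇒nCk≢0 k≤n}}) (ℕ.m≤m+n (n C k) (n C suc k))))

c[k+1]!²≤ck!*c[k+2]! : ∀ c k →
  (c ℕ.* suc k !) ℕ.* (c ℕ.* suc k !) ℕ.≤ (c ℕ.* k !) ℕ.* (c ℕ.* suc (suc k) !)
c[k+1]!²≤ck!*c[k+2]! c k =
  subst₂ ℕ._≤_ (lhs c k (k !)) (rhs c k (k !)) (ℕ.*-monoˡ-≤ (c ℕ.* c ℕ.* k ! ℕ.* suc k !) (ℕ.n≤1+n (suc k)))
  where
  lhs : ∀ c k f →
    suc k ℕ.* (c ℕ.* c ℕ.* f ℕ.* (suc k ℕ.* f)) ≡ (c ℕ.* (suc k ℕ.* f)) ℕ.* (c ℕ.* (suc k ℕ.* f))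
  lhs = ℕ-Solver.solve-∀
  rhs : ∀ c k f →
    suc (suc k) ℕ.* (c ℕ.* c ℕ.* f ℕ.* (suc k ℕ.* f)) ≡ (c ℕ.* f) ℕ.* (c ℕ.* (suc (suc k) ℕ.* (suc k ℕ.* f)))
  rhs = ℕ-Solver.solve-∀

sumPolys : List Poly → Poly
sumPolys []       m = 0ℚ
sumPolys (p ∷ ps) m = p m + sumPolys ps m

weightedSum-suc : ∀ k ps m → weightedSum (suc k) ps m ≡ weightedSum k ps m + sumPolys ps m
weightedSum-suc k []       m = sym (+-identityʳ 0ℚ)
weightedSum-suc k (p ∷ ps) m = begin
  ℕtoℚ (suc k) * p m + weightedSum (suc (suc k)) ps m
    ≡⟨ cong₂ (λ u v → u * p m + v) (ℕtoℚ-+ 1 k) (weightedSum-suc (suc k) ps m) ⟩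
  (1ℚ + ℕtoℚ k) * p m + (W + S)
    ≡⟨ solve 4 (λ n x W S → (con 1ℚ :+ n) :* x :+ (W :+ S) := (n :* x :+ W) :+ (x :+ S)) refl (ℕtoℚ k) (p m) W S ⟩
  (ℕtoℚ k * p m + W) + (p m + S) ∎
  where
  open ≡-Reasoning
  open +-*-Solver
  W S : ℚ
  W = weightedSum (suc k) ps m
  S = sumPolys ps m

d*[x+y]≡a+b : ∀ d a b {x y} →
  ℕtoℚ d * x ≡ ℕtoℚ a → ℕtoℚ d * y ≡ ℕtoℚ b → ℕtoℚ d * (x + y) ≡ ℕtoℚ (a ℕ.+ b)
d*[x+y]≡a+b d a b {x} {y} dx≡a dy≡b = begin
  ℕtoℚ d * (x + y)            ≡⟨ *-distribˡ-+ (ℕtoℚ d) x y ⟩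
  ℕtoℚ d * x + ℕtoℚ d * y     ≡⟨ cong₂ _+_ dx≡a dy≡b ⟩
  ℕtoℚ a + ℕtoℚ b             ≡⟨ ℕtoℚ-+ a b ⟨
  ℕtoℚ (a ℕ.+ b)              ∎
  where open ≡-Reasoning

WeightedSumCoeffs : ℕ → Set
WeightedSumCoeffs n = ∀ m → ℕtoℚ (m !) * weightedSum 1 (Ps n) m ≡ ℕtoℚ (suc n C suc m)

SumCoeffs : ℕ → Set
SumCoeffs n = ∀ m → ℕtoℚ (m !) * sumPolys (Ps n) m ≡ ℕtoℚ (n C m)

WeightedSumCoeffs⇒P[n+1]-coeff : ∀ n → WeightedSumCoeffs n →
  ∀ m → ℕtoℚ (m !) * P (suc n) m ≡ ℕtoℚ (C₋₁ n m)
WeightedSumCoeffs⇒P[n+1]-coeff n W≡ zero    = trans (*-identityˡ _) (*-zeroʳ (+ 1 / suc n))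
WeightedSumCoeffs⇒P[n+1]-coeff n W≡ (suc m) = begin
  ℕtoℚ (suc m !) * (r * W)
    ≡⟨ cong (_* (r * W)) (ℕtoℚ-* (suc m) (m !)) ⟩
  (ℕtoℚ (suc m) * ℕtoℚ (m !)) * (r * W)
    ≡⟨ solve 4 (λ s f r W → (s :* f) :* (r :* W) := r :* (s :* (f :* W))) refl (ℕtoℚ (suc m)) (ℕtoℚ (m !)) r W ⟩
  r * (ℕtoℚ (suc m) * (ℕtoℚ (m !) * W))
    ≡⟨ cong (λ u → r * (ℕtoℚ (suc m) * u)) (W≡ m) ⟩
  r * (ℕtoℚ (suc m) * ℕtoℚ (suc n C suc m))
    ≡⟨ cong (r *_) (ℕtoℚ-* (suc m) (suc n C suc m)) ⟨
  r * ℕtoℚ (suc m ℕ.* (suc n C suc m))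
    ≡⟨ cong (λ u → r * ℕtoℚ u) ([k+1]*[n+1]C[k+1]≡[n+1]*nCk n m) ⟩
  r * ℕtoℚ (suc n ℕ.* (n C m))
    ≡⟨ cong (r *_) (ℕtoℚ-* (suc n) (n C m)) ⟩
  r * (ℕtoℚ (suc n) * ℕtoℚ (n C m))
    ≡⟨ solve 3 (λ r s c → r :* (s :* c) := (s :* r) :* c) refl r (ℕtoℚ (suc n)) (ℕtoℚ (n C m)) ⟩
  (ℕtoℚ (suc n) * r) * ℕtoℚ (n C m)
    ≡⟨ cong (_* ℕtoℚ (n C m)) (trans (cong (ℕtoℚ (suc n) *_) (sym (*-identityˡ r))) (ℕtoℚ*1/ℕ≡1 (suc n))) ⟩
  1ℚ * ℕtoℚ (n C m)
    ≡⟨ *-identityˡ _ ⟩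
  ℕtoℚ (n C m) ∎
  where
  open ≡-Reasoning
  open +-*-Solver
  r W : ℚ
  r = + 1 / suc n
  W = weightedSum 1 (Ps n) m

sumCoeffs×weightedSumCoeffs : ∀ n → SumCoeffs n × WeightedSumCoeffs n
sumCoeffs×weightedSumCoeffs zero = S₀ , W₀
  where
  S₀ : SumCoeffs 0
  S₀ zero    = refl
  S₀ (suc m) = *-zeroʳ (ℕtoℚ (suc m !))
  W₀ : WeightedSumCoeffs 0
  W₀ zero    = refl
  W₀ (suc m) = *-zeroʳ (ℕtoℚ (suc m !))
sumCoeffs×weightedSumCoeffs (suc n) with sumCoeffs×weightedSumCoeffs n
... | S≡ , W≡ = S′ , W′
  where
  P≡ : ∀ m → ℕtoℚ (m !) * P (suc n) m ≡ ℕtoℚ (C₋₁ n m)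
  P≡ = WeightedSumCoeffs⇒P[n+1]-coeff n W≡
  S′ : SumCoeffs (suc n)
  S′ m = trans (d*[x+y]≡a+b (m !) (C₋₁ n m) (n C m) (P≡ m) (S≡ m)) (cong ℕtoℚ (sym ([n+1]Cm≡C₋₁+nCm n m)))
  W′ : WeightedSumCoeffs (suc n)
  W′ m = begin
    ℕtoℚ (m !) * weightedSum 1 (Ps (suc n)) m
      ≡⟨ cong (λ u → ℕtoℚ (m !) * (u + weightedSum 2 (Ps n) m)) (*-identityˡ (P (suc n) m)) ⟩
    ℕtoℚ (m !) * (P (suc n) m + weightedSum 2 (Ps n) m)
      ≡⟨ cong (λ u → ℕtoℚ (m !) * (P (suc n) m + u)) (weightedSum-suc 1 (Ps n) m) ⟩
    ℕtoℚ (m !) * (P (suc n) m + (weightedSum 1 (Ps n) m + sumPolys (Ps n) m))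
      ≡⟨ d*[x+y]≡a+b (m !) (C₋₁ n m) _ (P≡ m) (d*[x+y]≡a+b (m !) (suc n C suc m) (n C m) (W≡ m) (S≡ m)) ⟩
    ℕtoℚ (C₋₁ n m ℕ.+ (suc n C suc m ℕ.+ n C m))
      ≡⟨ cong ℕtoℚ (pascal² (C₋₁ n m) (suc n C suc m) (n C m)) ⟩
    ℕtoℚ ((C₋₁ n m ℕ.+ n C m) ℕ.+ suc n C suc m)
      ≡⟨ cong (λ u → ℕtoℚ (u ℕ.+ suc n C suc m)) ([n+1]Cm≡C₋₁+nCm n m) ⟨
    ℕtoℚ (suc n C m ℕ.+ suc n C suc m)
      ≡⟨ cong ℕtoℚ (nCk+nC[k+1]≡[n+1]C[k+1] (suc n) m) ⟩
    ℕtoℚ (suc (suc n) C suc m) ∎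
    where
    open ≡-Reasoning
    pascal² : ∀ a b c → a ℕ.+ (b ℕ.+ c) ≡ (a ℕ.+ c) ℕ.+ b
    pascal² = ℕ-Solver.solve-∀

P[n+1]-coeff : ∀ n m → ℕtoℚ (m !) * P (suc n) m ≡ ℕtoℚ (C₋₁ n m)
P[n+1]-coeff n = WeightedSumCoeffs⇒P[n+1]-coeff n (proj₂ (sumCoeffs×weightedSumCoeffs n))

a≡A/n! : ∀ n m → a n m ≡ divN (A n m) (n !)
a≡A/n! n m = d*x≡y⇒x≡y/d (n !) {{ℕ._!≢0 n}} refl

a[n+1,0]≡0 : ∀ n → a (suc n) 0 ≡ 0ℚ
a[n+1,0]≡0 n = trans (sym (*-identityˡ (P (suc n) 0))) (P[n+1]-coeff n 0)

a[n+1,m+1]≡nCm/[m+1]! : ∀ n m → a (suc n) (suc m) ≡ divN (ℕtoℚ (n C m)) (suc m !)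
a[n+1,m+1]≡nCm/[m+1]! n m = d*x≡y⇒x≡y/d (suc m !) {{ℕ._!≢0 (suc m)}} (P[n+1]-coeff n (suc m))

a[n+1]≥0 : ∀ n m → 0ℚ ≤ a (suc n) m
a[n+1]≥0 n zero    = ≤-reflexive (sym (a[n+1,0]≡0 n))
a[n+1]≥0 n (suc m) = subst (0ℚ ≤_) (sym (a[n+1,m+1]≡nCm/[m+1]! n m)) (divN-nonNeg (suc m !) (ℕtoℚ≥0 (n C m)))

a[n+1,k+1]/[n+1]C[k+1]≡1/[n+1]k! : ∀ n k → k ℕ.≤ n →
  divN (a (suc n) (suc k)) (suc n C suc k) ≡ 1/ℕ (suc n ℕ.* k !)
a[n+1,k+1]/[n+1]C[k+1]≡1/[n+1]k! n k k≤n = begin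
  divN (a (suc n) (suc k)) D
    ≡⟨ divN≡*1/ℕ _ D ⟩
  a (suc n) (suc k) * 1/ℕ D
    ≡⟨ cong (_* 1/ℕ D) (trans (a[n+1,m+1]≡nCm/[m+1]! n k) (divN≡*1/ℕ (ℕtoℚ c) (suc k !))) ⟩
  ℕtoℚ c * 1/ℕ (suc k !) * 1/ℕ D
    ≡⟨ trans (*-assoc (ℕtoℚ c) (1/ℕ (suc k !)) (1/ℕ D)) (cong (ℕtoℚ c *_) (sym (1/ℕ-* (suc k !) D))) ⟩
  ℕtoℚ c * 1/ℕ (suc k ! ℕ.* D)
    ≡⟨ cong (λ u → ℕtoℚ c * 1/ℕ u) [k+1]!D≡c[n+1]k! ⟩
  ℕtoℚ c * 1/ℕ (c ℕ.* (suc n ℕ.* k !))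
    ≡⟨ trans (cong (ℕtoℚ c *_) (1/ℕ-* c (suc n ℕ.* k !))) (sym (*-assoc (ℕtoℚ c) (1/ℕ c) (1/ℕ (suc n ℕ.* k !)))) ⟩
  ℕtoℚ c * 1/ℕ c * 1/ℕ (suc n ℕ.* k !)
    ≡⟨ cong (_* 1/ℕ (suc n ℕ.* k !)) (ℕtoℚ*1/ℕ≡1 c {{k≤n⇒nCk≢0 k≤n}}) ⟩
  1ℚ * 1/ℕ (suc n ℕ.* k !)
    ≡⟨ *-identityˡ _ ⟩
  1/ℕ (suc n ℕ.* k !) ∎
  where
  open ≡-Reasoning
  c D : ℕ
  c = n C k
  D = suc n C suc k
  [k+1]!D≡c[n+1]k! : suc k ! ℕ.* D ≡ c ℕ.* (suc n ℕ.* k !)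
  [k+1]!D≡c[n+1]k! = begin
    (suc k ℕ.* k !) ℕ.* D      ≡⟨ rearrangeˡ (suc k) (k !) D ⟩
    k ! ℕ.* (suc k ℕ.* D)      ≡⟨ cong (k ! ℕ.*_) ([k+1]*[n+1]C[k+1]≡[n+1]*nCk n k) ⟩
    k ! ℕ.* (suc n ℕ.* c)      ≡⟨ rearrangeʳ (k !) (suc n) c ⟩
    c ℕ.* (suc n ℕ.* k !)      ∎
    where
    rearrangeˡ : ∀ s f d → (s ℕ.* f) ℕ.* d ≡ f ℕ.* (s ℕ.* d)
    rearrangeˡ = ℕ-Solver.solve-∀
    rearrangeʳ : ∀ f s c → f ℕ.* (s ℕ.* c) ≡ c ℕ.* (s ℕ.* f)
    rearrangeʳ = ℕ-Solver.solve-∀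

a[n+1]/C-logConcave : ∀ n → LogConcave (suc n) (λ k → divN (a (suc n) k) (suc n C k))
a[n+1]/C-logConcave n (suc zero) _ _ = begin
  b 0 * b 2    ≡⟨ cong (λ q → divN q 1 * b 2) (a[n+1,0]≡0 n) ⟩
  0ℚ * b 2     ≡⟨ *-zeroˡ (b 2) ⟩
  0ℚ           ≤⟨ *-nonNeg (b≥0 1) (b≥0 1) ⟩
  b 1 * b 1    ∎
  where
  open ≤-Reasoning
  b : ℕ → ℚ
  b k = divN (a (suc n) k) (suc n C k)
  b≥0 : ∀ k → 0ℚ ≤ b k
  b≥0 k = divN-nonNeg (suc n C k) (a[n+1]≥0 n k)
a[n+1]/C-logConcave n (suc (suc j)) _ j+2≤n = begin
  b (suc j) * b (suc (suc (suc j)))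
    ≡⟨ cong₂ _*_ (b≡ j (ℕ.≤-trans (ℕ.m≤n+m j 2) j+2≤n)) (b≡ (suc (suc j)) j+2≤n) ⟩
  1/ℕ (c ℕ.* j !) * 1/ℕ (c ℕ.* suc (suc j) !)
    ≤⟨ 1/ℕ-*-antimono-≤ (c ℕ.* j !) (c ℕ.* suc j !) (c ℕ.* suc (suc j) !) {{c[j+1]!≢0}} (c[k+1]!²≤ck!*c[k+2]! c j) ⟩
  1/ℕ (c ℕ.* suc j !) * 1/ℕ (c ℕ.* suc j !)
    ≡⟨ cong₂ _*_ (b≡ (suc j) j+1≤n) (b≡ (suc j) j+1≤n) ⟨
  b (suc (suc j)) * b (suc (suc j)) ∎
  where
  open ≤-Reasoning
  c : ℕ
  c = suc n
  b : ℕ → ℚ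
  b k = divN (a (suc n) k) (suc n C k)
  b≡ : ∀ k → k ℕ.≤ n → b (suc k) ≡ 1/ℕ (c ℕ.* k !)
  b≡ = a[n+1,k+1]/[n+1]C[k+1]≡1/[n+1]k! n
  c[j+1]!≢0 : NonZero (c ℕ.* suc j !)
  c[j+1]!≢0 = ℕ.m*n≢0 c (suc j !) {{_}} {{ℕ._!≢0 (suc j)}}
  j+1≤n : suc j ℕ.≤ n
  j+1≤n = ℕ.≤-trans (ℕ.n≤1+n (suc j)) j+2≤n

mainTheorem10 : (n : ℕ) → 1 Data.Nat.≤ n →
    ((m : ℕ) → 1 Data.Nat.≤ m → m Data.Nat.≤ n →
        (a n m ≡ divN (A n m) (n !))
      × (a n m ≡ divN (ℕtoℚ ((n ∸ 1) C (m ∸ 1))) (m !)))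
    × NonNegSeq n (a n)
    × LogConcave n (λ k → divN (a n k) (n C k))
mainTheorem10 (suc n) _ =
    (λ { (suc m) _ _ → a≡A/n! (suc n) (suc m) , a[n+1,m+1]≡nCm/[m+1]! n m })
  , (λ m _ → a[n+1]≥0 n m)
  , a[n+1]/C-logConcave n
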